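{- Let $G$ be a graph and $X$ a cooperative set in $G$. Let $D_1,\dots,D_k$ be the connected components of $G\setminus N[X]$. Then for every $1\leq i\leq k$, the set $X\cup N_G(D_i)$ is a cooperative set in the graph $G[X\cup N[D_i]]$.
   Context: Graphs are finite and simple. For $X\subseteq V(G)$, $N(X)$ is the set of vertices outside $X$ with a neighbor in $X$, and $N[X]=N(X)\cup X$. For connected $X\subseteq V(G)$, the boundary $\delta^G(X)=\delta^G_1(X)$ is the set of vertices of $X$ having a neighbor in $V(G)\setminus X$, and $\delta^G_i(X)=\delta^G\left(X\setminus\bigcup_{k<i}\delta^G_k(X)\right)$. A connected set $X$ is cooperative in $G$ if: every vertex of $\delta^G_1(X)$ has a neighbor in $X\setminus\delta^G_1(X)$; every vertex of $\delta^G_2(X)$ has a neighbor in $X\setminus(\delta^G_1(X)\cup\delta^G_2(X))$; and $X\setminus(\delta^G_1(X)\cup\delta^G_2(X))$ is connected. -}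

module Defs where

open import Data.Nat using (ℕ; zero; suc)
open import Data.Bool using (Bool; true; false; _∧_; _∨_; not)
open import Data.Fin using (Fin; zero; suc)
open import Data.Fin.Subset using (Subset; _∈_; _⊆_; _∪_; _─_; ∁; Nonempty)
open import Data.Vec using (tabulate; lookup)
open import Data.Product using (Σ; _×_; ∃)
open import Relation.Binary.PropositionalEquality using (_≡_)

record Graph : Set where
  field
    n     : ℕ
    adj   : Fin n → Fin n → Bool
    sym   : ∀ u v → adj u v ≡ adj v u
    irrefl : ∀ v → adj v v ≡ false
open Graph public

anyFin : ∀ {m} → (Fin m → Bool) → Bool
anyFin {zero}  p = false
anyFin {suc m} p = p zero ∨ anyFin (λ i → p (suc i))

_∈ᵇ_ : ∀ {m} → Fin m → Subset m → Bool
v ∈ᵇ S = lookup S v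

N : (G : Graph) → Subset (n G) → Subset (n G)
N G X = tabulate λ v → not (v ∈ᵇ X) ∧ anyFin (λ u → adj G v u ∧ (u ∈ᵇ X))

N[_∣_] : (G : Graph) → Subset (n G) → Subset (n G)
N[ G ∣ X ] = N G X ∪ X

-- Boundary of X in the induced subgraph G[W]:
-- vertices of X having a neighbour in W ∖ X.
δ : (G : Graph) (W X : Subset (n G)) → Subset (n G)
δ G W X = tabulate λ v →
  (v ∈ᵇ X) ∧ anyFin (λ u → adj G v u ∧ (u ∈ᵇ W) ∧ not (u ∈ᵇ X))

-- inner G W X i = X ∖ (δ₁ ∪ … ∪ δᵢ), computed in G[W].
inner : (G : Graph) (W X : Subset (n G)) → ℕ → Subset (n G)
inner G W X zero    = X
inner G W X (suc i) = inner G W X i ─ δ G W (inner G W X i)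

-- δᵢ(X) in G[W] for i ≥ 1:  δ_{suc i} = δ (X ∖ ⋃_{k ≤ i} δ_k)
δ-iter : (G : Graph) (W X : Subset (n G)) → ℕ → Subset (n G)
δ-iter G W X i = δ G W (inner G W X i)

data Walk (G : Graph) (X : Subset (n G)) : Fin (n G) → Fin (n G) → Set where
  here : ∀ {u} → u ∈ X → Walk G X u u
  step : ∀ {u w v} → u ∈ X → adj G u w ≡ true → Walk G X w v → Walk G X u v

-- X is connected: nonempty and any two vertices of X joined by a walk inside X.
-- (Connectivity of X in an induced subgraph G[W] with X ⊆ W is the same.)
Connected : (G : Graph) → Subset (n G) → Set
Connected G X = Nonempty X × (∀ {u v} → u ∈ X → v ∈ X → Walk G X u v)

Cooperative : (G : Graph) (W X : Subset (n G)) → Set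
Cooperative G W X =
  X ⊆ W ×
  Connected G X ×
  (∀ {v} → v ∈ δ-iter G W X 0 →
     ∃ λ u → u ∈ inner G W X 1 × adj G v u ≡ true) ×
  (∀ {v} → v ∈ δ-iter G W X 1 →
     ∃ λ u → u ∈ inner G W X 2 × adj G v u ≡ true) ×
  Connected G (inner G W X 2)

Component : (G : Graph) (W D : Subset (n G)) → Set
Component G W D =
  D ⊆ W × Connected G D ×
  (∀ C → Connected G C → D ⊆ C → C ⊆ W → C ⊆ D)

-- A vertex of D adjacent to X would lie in N(X), so X has no neighbour in D.
-- Hence in G[X ∪ N[D]] the first boundary layer of X ∪ N(D) is exactly N(D),
-- and peeling it off leaves X. Maximality of the component D gives
-- N(D) ⊆ N(X), so every vertex of N(D) has a neighbour in X. The second layer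
-- is the boundary of X in the smaller graph, which lies inside its boundary in
-- G; so the cooperativity of X in G provides the required neighbours in
-- X ∖ δ(X) and the connectivity of X ∖ δ(X). Connectivity is transported
-- throughout by one fact: a set dominated by a connected subset is connected.
module Submission where

open import Data.Bool using (Bool; true; false; not; _∧_; _∨_)
open import Data.Bool.Properties using (∨-zeroʳ; ∧-conicalˡ; ∧-conicalʳ)
open import Data.Empty using (⊥-elim)
open import Data.Fin using (Fin; zero; suc)
open import Data.Fin.Subset using (Subset; ⊤; ∁; _∪_; _─_; _∈_; _∉_; _⊆_; inside; outside; ⁅_⁆)
open import Data.Fin.Subset.Properties
  using (⊆-antisym; ⊆⊤; p⊆p∪q; q⊆p∪q; x∈p∪q⁻; x∈p∪q⁺; x∈p∧x∉q⇒x∈p─q; p─q⊆p; _∈?_;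
         x∈⁅x⁆; x∈⁅y⁆⇒x≡y; x∈∁p⇒x∉p; x∉∁p⇒x∈p)
open import Data.Nat using (ℕ; zero; suc)
open import Data.Product using (∃; _×_; _,_; proj₁)
open import Data.Sum using (_⊎_; inj₁; inj₂; [_,_]′; map₂)
open import Data.Vec using (_∷_; here; there; tabulate)
open import Data.Vec.Properties using (lookup∘tabulate; []=⇒lookup; lookup⇒[]=)
open import Function using (_∘_; id)
open import Relation.Binary.PropositionalEquality using (_≡_; refl; sym; trans; cong; cong₂; subst)
open import Relation.Nullary using (yes; no)

open import Defs renaming (sym to adj-sym)

private variable
  m : ℕ

anyFin⁻ : (p : Fin m → Bool) → anyFin p ≡ true → ∃ λ i → p i ≡ true
anyFin⁻ {suc m} p h with p zero in p₀
... | true  = zero , p₀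
... | false = let i , pᵢ = anyFin⁻ (p ∘ suc) h in suc i , pᵢ

anyFin⁺ : (p : Fin m → Bool) (i : Fin m) → p i ≡ true → anyFin p ≡ true
anyFin⁺ p zero    pᵢ rewrite pᵢ = refl
anyFin⁺ p (suc i) pᵢ = trans (cong (p zero ∨_) (anyFin⁺ (p ∘ suc) i pᵢ)) (∨-zeroʳ (p zero))

module _ {S : Subset m} {v : Fin m} where

  ∈⇒∈ᵇ : v ∈ S → v ∈ᵇ S ≡ true
  ∈⇒∈ᵇ = []=⇒lookup

  ∈ᵇ⇒∈ : v ∈ᵇ S ≡ true → v ∈ S
  ∈ᵇ⇒∈ = lookup⇒[]= v S

  not∈ᵇ⇒∉ : not (v ∈ᵇ S) ≡ true → v ∉ S
  not∈ᵇ⇒∉ h v∈S with () ← trans (sym h) (cong not (∈⇒∈ᵇ v∈S))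

  ∉⇒not∈ᵇ : v ∉ S → not (v ∈ᵇ S) ≡ true
  ∉⇒not∈ᵇ v∉S with v ∈ᵇ S in h
  ... | true  = ⊥-elim (v∉S (∈ᵇ⇒∈ h))
  ... | false = refl

module _ {f : Fin m → Bool} {v : Fin m} where

  ∈-tabulate⁻ : v ∈ tabulate f → f v ≡ true
  ∈-tabulate⁻ v∈ = trans (sym (lookup∘tabulate f v)) (∈⇒∈ᵇ v∈)

  ∈-tabulate⁺ : f v ≡ true → v ∈ tabulate f
  ∈-tabulate⁺ fᵥ = ∈ᵇ⇒∈ (trans (lookup∘tabulate f v) fᵥ)

x∈p─q⇒x∉q : (p q : Subset m) {x : Fin m} → x ∈ p ─ q → x ∉ q
x∈p─q⇒x∉q (_ ∷ p) (outside ∷ q) here       ()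
x∈p─q⇒x∉q (_ ∷ p) (outside ∷ q) (there x∈) (there x∈q) = x∈p─q⇒x∉q p q x∈ x∈q
x∈p─q⇒x∉q (_ ∷ p) (inside  ∷ q) (there x∈) (there x∈q) = x∈p─q⇒x∉q p q x∈ x∈q

p─q⊆p─r : (p : Subset m) {q r : Subset m} → r ⊆ q → p ─ q ⊆ p ─ r
p─q⊆p─r p {q} r⊆q x∈ = x∈p∧x∉q⇒x∈p─q (p─q⊆p p q x∈) (x∈p─q⇒x∉q p q x∈ ∘ r⊆q)

p∪q─q≡p : (p q : Subset m) → (∀ {x} → x ∈ p → x ∉ q) → p ∪ q ─ q ≡ p
p∪q─q≡p p q p∩q≡∅ = ⊆-antisym ⊆p (λ x∈p → x∈p∧x∉q⇒x∈p─q (p⊆p∪q q x∈p) (p∩q≡∅ x∈p))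
  where
  ⊆p : p ∪ q ─ q ⊆ p
  ⊆p x∈ = [ id , (λ x∈q → ⊥-elim (x∈p─q⇒x∉q (p ∪ q) q x∈ x∈q)) ]′ (x∈p∪q⁻ p q (p─q⊆p _ _ x∈))

∪-monoʳ-⊆ : (p : Subset m) {q r : Subset m} → q ⊆ r → p ∪ q ⊆ p ∪ r
∪-monoʳ-⊆ p {q} q⊆r = x∈p∪q⁺ ∘ map₂ q⊆r ∘ x∈p∪q⁻ p q

module GraphProperties (G : Graph) where

  private variable
    A C C′ D W W′ X Y Z : Subset (n G)
    u v w : Fin (n G)

  -- N and δ unfold to tabulate, so Agda cannot infer the sets they are
  -- applied to; those sets are explicit arguments below.
  ∈N⁻ : ∀ X → v ∈ N G X → v ∉ X × ∃ λ u → adj G v u ≡ true × u ∈ X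
  ∈N⁻ X v∈ =
    let h     = ∈-tabulate⁻ v∈
        u , e = anyFin⁻ _ (∧-conicalʳ _ _ h)
    in not∈ᵇ⇒∉ (∧-conicalˡ _ _ h) , u , ∧-conicalˡ _ _ e , ∈ᵇ⇒∈ (∧-conicalʳ _ _ e)

  ∈N⁺ : v ∉ X → adj G v u ≡ true → u ∈ X → v ∈ N G X
  ∈N⁺ {u = u} v∉ e u∈ =
    ∈-tabulate⁺ (cong₂ _∧_ (∉⇒not∈ᵇ v∉) (anyFin⁺ _ u (cong₂ _∧_ e (∈⇒∈ᵇ u∈))))

  ∈δ⁻ : ∀ W X → v ∈ δ G W X → v ∈ X × ∃ λ u → adj G v u ≡ true × u ∈ W × u ∉ X
  ∈δ⁻ {v} W X v∈ =
    let h     = ∈-tabulate⁻ v∈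
        u , e = anyFin⁻ _ (∧-conicalʳ _ _ h)
        e′    = ∧-conicalʳ (adj G v u) _ e
    in ∈ᵇ⇒∈ (∧-conicalˡ _ _ h) , u , ∧-conicalˡ _ _ e , ∈ᵇ⇒∈ (∧-conicalˡ _ _ e′) ,
       not∈ᵇ⇒∉ (∧-conicalʳ _ _ e′)

  ∈δ⁺ : v ∈ X → adj G v u ≡ true → u ∈ W → u ∉ X → v ∈ δ G W X
  ∈δ⁺ {u = u} v∈ e u∈W u∉X =
    ∈-tabulate⁺ (cong₂ _∧_ (∈⇒∈ᵇ v∈)
      (anyFin⁺ _ u (cong₂ _∧_ e (cong₂ _∧_ (∈⇒∈ᵇ u∈W) (∉⇒not∈ᵇ u∉X)))))

  δ-mono : ∀ X → W ⊆ W′ → δ G W X ⊆ δ G W′ X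
  δ-mono {W} X W⊆W′ v∈ = let v∈X , u , e , u∈W , u∉X = ∈δ⁻ W X v∈ in ∈δ⁺ v∈X e (W⊆W′ u∈W) u∉X

  walk-++ : Walk G A u v → Walk G A v w → Walk G A u w
  walk-++ (here _)     q = q
  walk-++ (step a e p) q = step a e (walk-++ p q)

  walk-⊆ : A ⊆ C → Walk G A u v → Walk G C u v
  walk-⊆ A⊆C (here a)     = here (A⊆C a)
  walk-⊆ A⊆C (step a e p) = step (A⊆C a) e (walk-⊆ A⊆C p)

  Dominates : Subset (n G) → Subset (n G) → Set
  Dominates A C = ∀ {v} → v ∈ C → v ∈ A ⊎ ∃ λ u → u ∈ A × adj G v u ≡ true

  Dominates-⊆ : C ⊆ C′ → Dominates A C′ → Dominates A C
  Dominates-⊆ C⊆C′ dom = dom ∘ C⊆C′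

  Connected-dominated : Connected G A → A ⊆ C → Dominates A C → Connected G C
  Connected-dominated {A} {C} ((a , a∈A) , walk) A⊆C dom = (a , A⊆C a∈A) , λ u∈ v∈ →
    let a , a∈A , p = walk-to-A u∈
        b , b∈A , q = walk-from-A v∈
    in walk-++ p (walk-++ (walk-⊆ A⊆C (walk a∈A b∈A)) q)
    where
    walk-to-A : u ∈ C → ∃ λ a → a ∈ A × Walk G C u a
    walk-to-A {u} u∈ with dom u∈
    ... | inj₁ u∈A           = u , u∈A , here u∈
    ... | inj₂ (a , a∈A , e) = a , a∈A , step u∈ e (here (A⊆C a∈A))

    walk-from-A : v ∈ C → ∃ λ a → a ∈ A × Walk G C a v
    walk-from-A {v} v∈ with dom v∈
    ... | inj₁ v∈A           = v , v∈A , here v∈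
    ... | inj₂ (a , a∈A , e) = a , a∈A , step (A⊆C a∈A) (trans (adj-sym G a v) e) (here v∈)

  ∈⇒∉N : v ∈ X → v ∉ N G X
  ∈⇒∉N {X = X} v∈X v∈N = proj₁ (∈N⁻ X v∈N) v∈X

  N-neighbour : ∀ X → v ∈ N G X → ∃ λ u → u ∈ X × adj G v u ≡ true
  N-neighbour X v∈N = let _ , u , e , u∈X = ∈N⁻ X v∈N in u , u∈X , e

  N-dominated : ∀ X → Dominates X (X ∪ N G X)
  N-dominated X = map₂ (N-neighbour X) ∘ x∈p∪q⁻ X (N G X)

  inner-dominated : ∀ W X i →
    (∀ {v} → v ∈ δ-iter G W X i → ∃ λ u → u ∈ inner G W X (suc i) × adj G v u ≡ true) →
    Dominates (inner G W X (suc i)) (inner G W X i)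
  inner-dominated W X i anchored {v} v∈ with v ∈? δ-iter G W X i
  ... | yes v∈δ = inj₂ (anchored v∈δ)
  ... | no  v∉δ = inj₁ (x∈p∧x∉q⇒x∈p─q v∈ v∉δ)

  module _ (W⊆W′ : W ⊆ W′) where

    inner₁-anti : ∀ X → inner G W′ X 1 ⊆ inner G W X 1
    inner₁-anti X = p─q⊆p─r X (δ-mono X W⊆W′)

    Cooperative-anchored₀-⊆ : Cooperative G W′ X →
      v ∈ δ G W X → ∃ λ u → u ∈ inner G W X 1 × adj G v u ≡ true
    Cooperative-anchored₀-⊆ {X} (_ , _ , anchored₀ , _) v∈ =
      let u , u∈ , e = anchored₀ (δ-mono X W⊆W′ v∈) in u , inner₁-anti X u∈ , e

    Cooperative-inner₁-connected-⊆ : Cooperative G W′ X → Connected G (inner G W X 1)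
    Cooperative-inner₁-connected-⊆ {X} (_ , _ , anchored₀ , anchored₁ , inner₂-conn) =
      Connected-dominated inner₁-conn (inner₁-anti X)
        (Dominates-⊆ (p─q⊆p _ _) (inner-dominated W′ X 0 anchored₀))
      where
      inner₁-conn : Connected G (inner G W′ X 1)
      inner₁-conn = Connected-dominated inner₂-conn (p─q⊆p _ _) (inner-dominated W′ X 1 anchored₁)

  Cooperative-via-inner₁ : Y ⊆ W → Connected G Y → inner G W Y 1 ≡ Z →
    (∀ {v} → v ∈ δ G W Y → ∃ λ u → u ∈ Z × adj G v u ≡ true) →
    (∀ {v} → v ∈ δ G W Z → ∃ λ u → u ∈ Z ─ δ G W Z × adj G v u ≡ true) →
    Connected G (Z ─ δ G W Z) →
    Cooperative G W Y
  Cooperative-via-inner₁ Y⊆W Y-conn refl anchored₀ anchored₁ core-conn =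
    Y⊆W , Y-conn , anchored₀ , anchored₁ , core-conn

  -- Otherwise D ∪ {v} would be a strictly larger connected subset of W.
  N-Component-disjoint : Component G W D → v ∈ N G D → v ∉ W
  N-Component-disjoint {W} {D} {v} (D⊆W , D-conn , D-maximal) v∈ND v∈W =
    v∉D (D-maximal (D ∪ ⁅ v ⁆) (Connected-dominated D-conn (p⊆p∪q _) dom) (p⊆p∪q _) D+v⊆W
                   (q⊆p∪q D ⁅ v ⁆ (x∈⁅x⁆ v)))
    where
    v∉D : v ∉ D
    v∉D = proj₁ (∈N⁻ D v∈ND)

    dom : Dominates D (D ∪ ⁅ v ⁆)
    dom w∈ with x∈p∪q⁻ D ⁅ v ⁆ w∈
    ... | inj₁ w∈D = inj₁ w∈D
    ... | inj₂ w∈v rewrite x∈⁅y⁆⇒x≡y v w∈v = inj₂ (N-neighbour D v∈ND)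

    D+v⊆W : D ∪ ⁅ v ⁆ ⊆ W
    D+v⊆W w∈ with x∈p∪q⁻ D ⁅ v ⁆ w∈
    ... | inj₁ w∈D = D⊆W w∈D
    ... | inj₂ w∈v rewrite x∈⁅y⁆⇒x≡y v w∈v = v∈W

  module _ (X D : Subset (n G)) (D-avoids : D ⊆ ∁ N[ G ∣ X ]) where

    avoids-∉ : u ∈ D → u ∉ X
    avoids-∉ u∈D = x∈∁p⇒x∉p (D-avoids u∈D) ∘ q⊆p∪q (N G X) X

    avoids-no-edge : v ∈ X → adj G v u ≡ true → u ∉ D
    avoids-no-edge {v} {u} v∈X e u∈D =
      x∈∁p⇒x∉p (D-avoids u∈D) (p⊆p∪q X (∈N⁺ (avoids-∉ u∈D) (trans (adj-sym G u v) e) v∈X))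

    avoids-disjoint-N : v ∈ X → v ∉ N G D
    avoids-disjoint-N v∈X v∈ND = let _ , _ , e , u∈D = ∈N⁻ D v∈ND in avoids-no-edge v∈X e u∈D

    boundary-extension : δ G (X ∪ N[ G ∣ D ]) (X ∪ N G D) ≡ N G D
    boundary-extension = ⊆-antisym δ⊆ND ND⊆δ
      where
      outside-in-D : u ∈ X ∪ N[ G ∣ D ] → u ∉ X ∪ N G D → u ∈ D
      outside-in-D u∈ u∉ with x∈p∪q⁻ X N[ G ∣ D ] u∈
      ... | inj₁ u∈X = ⊥-elim (u∉ (p⊆p∪q _ u∈X))
      ... | inj₂ u∈N[D] with x∈p∪q⁻ (N G D) D u∈N[D]
      ...   | inj₁ u∈ND = ⊥-elim (u∉ (q⊆p∪q X _ u∈ND))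
      ...   | inj₂ u∈D  = u∈D

      δ⊆ND : δ G (X ∪ N[ G ∣ D ]) (X ∪ N G D) ⊆ N G D
      δ⊆ND v∈ =
        let v∈Y , u , e , u∈W , u∉Y = ∈δ⁻ (X ∪ N[ G ∣ D ]) (X ∪ N G D) v∈
            v∉X v∈X = avoids-no-edge v∈X e (outside-in-D u∈W u∉Y)
        in [ ⊥-elim ∘ v∉X , id ]′ (x∈p∪q⁻ X (N G D) v∈Y)

      ND⊆δ : N G D ⊆ δ G (X ∪ N[ G ∣ D ]) (X ∪ N G D)
      ND⊆δ v∈ND =
        let _ , u , e , u∈D = ∈N⁻ D v∈ND
        in ∈δ⁺ (q⊆p∪q X _ v∈ND) e (q⊆p∪q X _ (q⊆p∪q (N G D) D u∈D))
               ([ avoids-∉ u∈D , ∈⇒∉N u∈D ]′ ∘ x∈p∪q⁻ X (N G D))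

    inner₁-extension : inner G (X ∪ N[ G ∣ D ]) (X ∪ N G D) 1 ≡ X
    inner₁-extension =
      trans (cong (X ∪ N G D ─_) boundary-extension) (p∪q─q≡p X (N G D) avoids-disjoint-N)

  N-Component-⊆ : Component G (∁ N[ G ∣ X ]) D → N G D ⊆ N G X
  N-Component-⊆ {X = X} {D = D} D-comp@(D-avoids , _) v∈ND
    with x∈p∪q⁻ (N G X) X (x∉∁p⇒x∈p (N-Component-disjoint D-comp v∈ND))
  ... | inj₁ v∈NX = v∈NX
  ... | inj₂ v∈X  = ⊥-elim (avoids-disjoint-N X D D-avoids v∈X v∈ND)

lemma5p4 : (G : Graph) (X : Subset (n G)) →
    Cooperative G ⊤ X →
    (D : Subset (n G)) → Component G (∁ N[ G ∣ X ]) D →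
    Cooperative G (X ∪ N[ G ∣ D ]) (X ∪ N G D)
lemma5p4 G X X-coop@(_ , X-conn , _) D D-comp@(D-avoids , _) =
  Cooperative-via-inner₁ (∪-monoʳ-⊆ X (p⊆p∪q D)) Y-conn (inner₁-extension X D D-avoids) ND-anchored
    (Cooperative-anchored₀-⊆ W⊆⊤ X-coop) (Cooperative-inner₁-connected-⊆ W⊆⊤ X-coop)
  where
  open GraphProperties G

  W⊆⊤ : X ∪ N[ G ∣ D ] ⊆ ⊤
  W⊆⊤ = ⊆⊤

  ND⊆NX : N G D ⊆ N G X
  ND⊆NX = N-Component-⊆ {X = X} D-comp

  Y-conn : Connected G (X ∪ N G D)
  Y-conn = Connected-dominated X-conn (p⊆p∪q _) (Dominates-⊆ (∪-monoʳ-⊆ X ND⊆NX) (N-dominated X))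

  ND-anchored : ∀ {v} → v ∈ δ G (X ∪ N[ G ∣ D ]) (X ∪ N G D) → ∃ λ u → u ∈ X × adj G v u ≡ true
  ND-anchored = N-neighbour X ∘ ND⊆NX ∘ subst (_ ∈_) (boundary-extension X D D-avoids)
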